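{- For every integer $d\ge 2$, $\chi_d(G_3)=3d+1$.
   Context: $G_3$ denotes the integer distance graph $G(\mathbb{Z},\{2,3\})$: its vertex set is $\mathbb{Z}$, and distinct $i,j\in\mathbb{Z}$ are adjacent if and only if $|i-j|\in\{2,3\}$. For a graph $G$ and a positive integer $d$, a $d$-distance $k$-coloring is a map $f:V(G)\to\{1,\ldots,k\}$ such that any two distinct vertices $u,v$ with $f(u)=f(v)$ satisfy $d_G(u,v)>d$ ($d_G$ the shortest-path distance); $\chi_d(G)$ is the smallest such $k$. -}

module Defs where

open import Data.Nat using (ℕ; zero; suc; _≤_)
open import Data.Integer using (ℤ; +_; ∣_∣; _-_)
open import Data.Fin using (Fin)
open import Data.Product using (Σ; _×_; ∃-syntax)
open import Data.Sum using (_⊎_)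
open import Relation.Binary.PropositionalEquality using (_≡_; _≢_)
open import Relation.Nullary using (¬_)

-- Adjacency in G_3 = G(ℤ, {2,3}): |i - j| ∈ {2,3}
Adj : ℤ → ℤ → Set
Adj i j = (∣ i - j ∣ ≡ 2) ⊎ (∣ i - j ∣ ≡ 3)

data Walk : ℕ → ℤ → ℤ → Set where
  nil  : ∀ {u} → Walk zero u u
  cons : ∀ {n u w v} → Adj u w → Walk n w v → Walk (suc n) u v

-- d_{G_3}(u,v) ≤ d  (shortest-path distance is the least walk length)
DistLe : ℤ → ℤ → ℕ → Set
DistLe u v d = ∃[ n ] (n ≤ d × Walk n u v)

IsDistColoring : (d k : ℕ) → (ℤ → Fin k) → Set
IsDistColoring d k f = ∀ u v → u ≢ v → f u ≡ f v → ¬ DistLe u v d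

ChiDEq : (d m : ℕ) → Set
ChiDEq d m = Σ (ℤ → Fin m) (IsDistColoring d m)
           × (∀ k → k Data.Nat.< m → (f : ℤ → Fin k) → ¬ IsDistColoring d k f)

-- A walk of length n in G_3 moves at most 3n, so vertices at distance at most d differ by at most
-- 3d, and colouring an integer by its residue modulo 3d + 1 is a d-distance colouring. Conversely,
-- for d ≥ 2 any two of the 3d + 1 integers 0, …, 3d are within distance d of each other (advance
-- by 3 while possible, then finish the remaining gap of at most 6 in two steps), so by pigeonhole
-- no colouring with fewer than 3d + 1 colours exists.
module Submission where

open import Defs
open import Data.Nat using (ℕ; _≤_; _+_; _*_)
open import Data.Nat.Base using (zero; suc; z≤n; s≤s; s≤s⁻¹; _<_; _∸_; NonZero; ≢-nonZero)
import Data.Nat.Properties as ℕ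
open import Data.Nat.Divisibility using (_∣_; divides; >⇒∤)
open import Data.Integer as ℤ using (ℤ; +_; ∣_∣; _-_)
import Data.Integer.Properties as ℤ
open import Data.Integer.DivMod using (_%ℕ_; _/ℕ_; n%ℕd<d; a≡a%ℕn+[a/ℕn]*n)
open import Data.Integer.Tactic.RingSolver using (solve-∀)
open import Data.Fin using (Fin; toℕ; fromℕ<)
import Data.Fin.Properties as Fin
open import Data.Product using (_,_)
open import Data.Sum using (_⊎_; inj₁; inj₂)
open import Data.Empty using (⊥-elim)
open import Relation.Binary.PropositionalEquality
open import Relation.Nullary using (¬_)

Adj⇒∣-∣≤3 : ∀ {u w} → Adj u w → ∣ u - w ∣ ≤ 3
Adj⇒∣-∣≤3 (inj₁ eq) = ℕ.≤-trans (ℕ.≤-reflexive eq) (ℕ.n≤1+n 2)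
Adj⇒∣-∣≤3 (inj₂ eq) = ℕ.≤-reflexive eq

Walk⇒∣-∣≤3* : ∀ {n u v} → Walk n u v → ∣ u - v ∣ ≤ 3 * n
Walk⇒∣-∣≤3* {u = u} nil = ℕ.≤-reflexive (cong ∣_∣ (ℤ.+-inverseʳ u))
Walk⇒∣-∣≤3* {suc n} {u} {v} (cons {w = w} u~w walk) = begin
    ∣ u - v ∣               ≡⟨ cong ∣_∣ (split u w v) ⟩
    ∣ (u - w) ℤ.+ (w - v) ∣ ≤⟨ ℤ.∣i+j∣≤∣i∣+∣j∣ (u - w) (w - v) ⟩
    ∣ u - w ∣ + ∣ w - v ∣   ≤⟨ ℕ.+-mono-≤ (Adj⇒∣-∣≤3 {u} {w} u~w) (Walk⇒∣-∣≤3* walk) ⟩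
    3 + 3 * n               ≡⟨ ℕ.*-suc 3 n ⟨
    3 * suc n               ∎
  where
  open ℕ.≤-Reasoning
  split : ∀ u w v → u - v ≡ (u - w) ℤ.+ (w - v)
  split = solve-∀

DistLe⇒∣-∣≤3* : ∀ {u v d} → DistLe u v d → ∣ u - v ∣ ≤ 3 * d
DistLe⇒∣-∣≤3* (n , n≤d , walk) = ℕ.≤-trans (Walk⇒∣-∣≤3* walk) (ℕ.*-monoʳ-≤ 3 n≤d)

Adj-translate : ∀ u {i j} → Adj i j → Adj (u ℤ.+ i) (u ℤ.+ j)
Adj-translate u {i} {j} = subst (λ n → n ≡ 2 ⊎ n ≡ 3) (cong ∣_∣ (sym (cancel u i j)))
  where
  cancel : ∀ u i j → (u ℤ.+ i) - (u ℤ.+ j) ≡ i - j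
  cancel = solve-∀

Walk-translate : ∀ u {n i j} → Walk n i j → Walk n (u ℤ.+ i) (u ℤ.+ j)
Walk-translate u nil              = nil
Walk-translate u (cons i~w walk) = cons (Adj-translate u i~w) (Walk-translate u walk)

DistLe-translate : ∀ u {i j d} → DistLe i j d → DistLe (u ℤ.+ i) (u ℤ.+ j) d
DistLe-translate u (n , n≤d , walk) = n , n≤d , Walk-translate u walk

DistLe-step : ∀ {u w v d} → Adj u w → DistLe w v d → DistLe u v (suc d)
DistLe-step u~w (n , n≤d , walk) = suc n , s≤s n≤d , cons u~w walk

DistLe-mono : ∀ {u v d d′} → d ≤ d′ → DistLe u v d → DistLe u v d′
DistLe-mono d≤d′ (n , n≤d , walk) = n , ℕ.≤-trans n≤d d≤d′ , walk

≤6⇒DistLe-0-2 : ∀ t → t ≤ 6 → DistLe (+ 0) (+ t) 2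
≤6⇒DistLe-0-2 0 _ = 0 , z≤n , nil
≤6⇒DistLe-0-2 1 _ = 2 , ℕ.≤-refl , cons {w = + 3} (inj₂ refl) (cons (inj₁ refl) nil)
≤6⇒DistLe-0-2 2 _ = 1 , s≤s z≤n , cons (inj₁ refl) nil
≤6⇒DistLe-0-2 3 _ = 1 , s≤s z≤n , cons (inj₂ refl) nil
≤6⇒DistLe-0-2 4 _ = 2 , ℕ.≤-refl , cons {w = + 2} (inj₁ refl) (cons (inj₁ refl) nil)
≤6⇒DistLe-0-2 5 _ = 2 , ℕ.≤-refl , cons {w = + 2} (inj₁ refl) (cons (inj₂ refl) nil)
≤6⇒DistLe-0-2 6 _ = 2 , ℕ.≤-refl , cons {w = + 3} (inj₂ refl) (cons (inj₂ refl) nil)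
≤6⇒DistLe-0-2 (suc (suc (suc (suc (suc (suc (suc _))))))) (s≤s (s≤s (s≤s (s≤s (s≤s (s≤s ()))))))

≤3*⇒DistLe-0 : ∀ e t → t ≤ 3 * (2 + e) → DistLe (+ 0) (+ t) (2 + e)
≤3*⇒DistLe-0 zero    t t≤6 = ≤6⇒DistLe-0-2 t t≤6
≤3*⇒DistLe-0 (suc e) 0 _   = DistLe-mono (ℕ.m≤m+n 2 (suc e)) (≤6⇒DistLe-0-2 0 z≤n)
≤3*⇒DistLe-0 (suc e) 1 _   = DistLe-mono (ℕ.m≤m+n 2 (suc e)) (≤6⇒DistLe-0-2 1 (s≤s z≤n))
≤3*⇒DistLe-0 (suc e) 2 _   = DistLe-mono (ℕ.m≤m+n 2 (suc e)) (≤6⇒DistLe-0-2 2 (s≤s (s≤s z≤n)))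
≤3*⇒DistLe-0 (suc e) (suc (suc (suc t))) 3+t≤3[3+e] =
  DistLe-step (inj₂ refl) (DistLe-translate (+ 3) (≤3*⇒DistLe-0 e t t≤3[2+e]))
  where
  t≤3[2+e] : t ≤ 3 * (2 + e)
  t≤3[2+e] = ℕ.+-cancelˡ-≤ 3 t _ (subst (3 + t ≤_) (ℕ.*-suc 3 (2 + e)) 3+t≤3[3+e])

≤3*⇒DistLe : ∀ {d} → 2 ≤ d → ∀ u t → t ≤ 3 * d → DistLe u (u ℤ.+ + t) d
≤3*⇒DistLe {suc zero} (s≤s ())
≤3*⇒DistLe {suc (suc e)} _ u t t≤3d =
  subst (λ w → DistLe w (u ℤ.+ + t) (2 + e)) (ℤ.+-identityʳ u)
        (DistLe-translate u (≤3*⇒DistLe-0 e t t≤3d))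

∣∧<⇒≡0 : ∀ {m n} → m ∣ n → n < m → n ≡ 0
∣∧<⇒≡0 {n = zero}  _   _   = refl
∣∧<⇒≡0 {n = suc _} m∣n n<m = ⊥-elim (>⇒∤ n<m m∣n)

residue : ∀ m .{{_ : NonZero m}} → ℤ → Fin m
residue m u = fromℕ< (n%ℕd<d u m)

residue-injective-on-short-gaps : ∀ m .{{_ : NonZero m}} {u v} →
  residue m u ≡ residue m v → ∣ u - v ∣ < m → u ≡ v
residue-injective-on-short-gaps m {u} {v} same gap<m =
  ℤ.i-j≡0⇒i≡j u v (ℤ.∣i∣≡0⇒i≡0 (∣∧<⇒≡0 m∣gap gap<m))
  where
  r q : ℤ
  r = + (u %ℕ m)
  q = u /ℕ m ℤ.- v /ℕ m

  v≡r+[v/m]*m : v ≡ r ℤ.+ v /ℕ m ℤ.* + m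
  v≡r+[v/m]*m = trans (a≡a%ℕn+[a/ℕn]*n v m) (cong (λ r′ → + r′ ℤ.+ v /ℕ m ℤ.* + m)
    (sym (Fin.fromℕ<-injective _ _ (n%ℕd<d u m) (n%ℕd<d v m) same)))

  u-v≡q*m : u - v ≡ q ℤ.* + m
  u-v≡q*m = begin
    u - v                                           ≡⟨ cong₂ _-_ (a≡a%ℕn+[a/ℕn]*n u m) v≡r+[v/m]*m ⟩
    (r ℤ.+ u /ℕ m ℤ.* + m) - (r ℤ.+ v /ℕ m ℤ.* + m) ≡⟨ cancel r (u /ℕ m) (v /ℕ m) (+ m) ⟩
    q ℤ.* + m                                       ∎
    where
    open ≡-Reasoning
    cancel : ∀ r a b m → (r ℤ.+ a ℤ.* m) - (r ℤ.+ b ℤ.* m) ≡ (a - b) ℤ.* m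
    cancel = solve-∀

  m∣gap : m ∣ ∣ u - v ∣
  m∣gap = divides ∣ q ∣ (trans (cong ∣_∣ u-v≡q*m) (ℤ.∣i*j∣≡∣i∣*∣j∣ q (+ m)))

3*d+1-nonZero : ∀ d → NonZero (3 * d + 1)
3*d+1-nonZero d = ≢-nonZero (ℕ.m+1+n≢0 (3 * d))

residue-isDistColoring : ∀ d →
  IsDistColoring d (3 * d + 1) (residue (3 * d + 1) {{3*d+1-nonZero d}})
residue-isDistColoring d u v u≢v same dist =
  u≢v (residue-injective-on-short-gaps (3 * d + 1) {{3*d+1-nonZero d}} same gap<m)
  where
  gap<m : ∣ u - v ∣ < 3 * d + 1
  gap<m = subst (∣ u - v ∣ <_) (ℕ.+-comm 1 (3 * d)) (s≤s (DistLe⇒∣-∣≤3* dist))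

no-smaller-DistColoring : ∀ d → 2 ≤ d → ∀ k → k < 3 * d + 1 → (f : ℤ → Fin k) →
  ¬ IsDistColoring d k f
no-smaller-DistColoring d 2≤d k k<m f isColoring
  with i , j , i<j , same ← Fin.pigeonhole k<m (λ i → f (+ toℕ i))
  = isColoring (+ toℕ i) (+ toℕ j) i≢j same close
  where
  i≢j : + toℕ i ≢ + toℕ j
  i≢j eq = ℕ.<-irrefl (ℤ.+-injective eq) i<j

  gap≤3d : toℕ j ∸ toℕ i ≤ 3 * d
  gap≤3d = ℕ.≤-trans (ℕ.m∸n≤m (toℕ j) (toℕ i))
    (s≤s⁻¹ (subst (toℕ j <_) (ℕ.+-comm (3 * d) 1) (Fin.toℕ<n j)))

  j≡i+gap : + toℕ i ℤ.+ + (toℕ j ∸ toℕ i) ≡ + toℕ j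
  j≡i+gap = trans (sym (ℤ.pos-+ (toℕ i) _)) (cong +_ (ℕ.m+[n∸m]≡n (ℕ.<⇒≤ i<j)))

  close : DistLe (+ toℕ i) (+ toℕ j) d
  close = subst (λ w → DistLe (+ toℕ i) w d) j≡i+gap
                (≤3*⇒DistLe 2≤d (+ toℕ i) (toℕ j ∸ toℕ i) gap≤3d)

corollary7 : ∀ (d : ℕ) → 2 ≤ d → ChiDEq d (3 * d + 1)
corollary7 d 2≤d =
  (residue (3 * d + 1) {{3*d+1-nonZero d}} , residue-isDistColoring d) , no-smaller-DistColoring d 2≤d
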